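{- Let $\mathcal P=\{0,1\}$. There exists a local IPDL formula $\alpha$ (which may use the atomic propositions $(a,b)$, $a,b\in\{0,1\}$) such that for every $m\ge1$ and every $c:V_m\to\{0,1\}^2$ satisfying [$c(g(i,j))=(0,0)$ iff $i=0$, for all $(i,j)\in G_m$], we have $(M_m,c)\models\mathsf A\alpha$ if and only if $c(g(i,j))=c(g(i,j+i))$ for all $(i,j)\in G_m$.
   Context: For processes $\mathcal P=\{0,1\}$: $\Sigma=\{0!1,0?1,1!0,1?0\}$. An MSC is a $\Sigma$-labeled partial order $(V,\le,\lambda)$ in which events of each process are linearly ordered, $\le$ is generated by the process successor relation $\mathrm{proc}$ (consecutive events of one process) and the message relation $\mathrm{msg}$ (the $k$-th $p!q$-event is matched with the $k$-th $q?p$-event, FIFO), down-sets are finite, and numbers of sends and receives on each channel agree. For $m\ge1$, $M_m=(V_m,\le,\lambda)$ is the MSC in which process $0$ executes the event sequence $(0!1)^m((0?1)(0!1))^\omega$ and process $1$ executes $(1?0)((1?0)(1!0))^\omega$. Let $G_m=\{0,\dots,m-1\}\times\mathbb N$. For the $k$-th ($k\ge1$) send event $v$ of process $0$ set $f(v)=((m-k)\bmod m,\ (k-1)\,\mathrm{div}\,m)$ (nonnegative residue); $f$ is a bijection from the set of $0!1$-events onto $G_m$, with inverse $g$. IPDL over MSCs with a labeling $c:V\to\{0,1\}^2$: path expressions $\pi::=\mathrm{proc}\mid\mathrm{msg}\mid\{\alpha\}\mid\pi;\pi\mid\pi+\pi\mid\pi^*$; local formulas $\alpha::=\mathrm{true}\mid\sigma\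 (\sigma\in\Sigma)\mid(a,b)\ (a,b\in\{0,1\})\mid\alpha\lor\alpha\mid\neg\alpha\mid\langle\pi\rangle\alpha\mid\langle\pi\rangle^{ -1}\alpha\mid\langle\pi_1\cap\pi_2\rangle\alpha$. Define $R_\pi\subseteq V\times V$: $R_{\mathrm{proc}}=\mathrm{proc}$, $R_{\mathrm{msg}}=\mathrm{msg}$, $R_{\{\alpha\}}=\{(v,v):v\models\alpha\}$, $R_{\pi_1;\pi_2}=R_{\pi_1}\circ R_{\pi_2}$ (first $R_{\pi_1}$, then $R_{\pi_2}$), $R_{\pi_1+\pi_2}=R_{\pi_1}\cup R_{\pi_2}$, $R_{\pi^*}$ the reflexive-transitive closure. $(M,c),v\models\sigma$ iff $\lambda(v)=\sigma$; $(M,c),v\models(a,b)$ iff $c(v)=(a,b)$; Booleans as usual; $\langle\pi\rangle\alpha$ iff some $w$ with $(v,w)\in R_\pi$ satisfies $\alpha$; $\langle\pi_1\cap\pi_2\rangle\alpha$ iff some $w$ with $(v,w)\in R_{\pi_1}\cap R_{\pi_2}$ satisfies $\alpha$; $\langle\pi\rangle^{ -1}\alpha$ iff some $w$ with $(w,v)\in R_{\pi'}$ satisfies $\alpha$, where $\pi'$ is $\pi$ with every concatenation reversed (equivalently: backward modalities follow $\mathrm{proc}^{ -1},\mathrm{msg}^{ -1}$, with $\langle\pi_1;\pi_2\rangle^{ -1}\alpha\equiv\langle\pi_1\rangle^{ -1}\langle\pi_2\rangle^{ -1}\alpha$). $(M,c)\models\mathsf A\alpha$ iff every node satisfies $\alpha$.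 -}

module Defs where

open import Data.Nat using (ℕ; zero; suc; _∸_; _/_; _<ᵇ_; NonZero)
open import Data.Bool using (Bool; true; false; if_then_else_)
open import Data.Product using (_×_; _,_; ∃; Σ)
open import Data.Sum using (_⊎_)
open import Relation.Nullary using (¬_)
open import Relation.Binary.PropositionalEquality using (_≡_)
open import Relation.Binary.Construct.Closure.ReflexiveTransitive using (Star)
open import Data.Integer using (ℤ; +_; _-_)
open import Data.Integer.DivMod using (_%ℕ_)

data Proc : Set where
  p0 p1 : Proc

other : Proc → Proc
other p0 = p1
other p1 = p0

-- Σ = {0!1, 0?1, 1!0, 1?0}
data Act : Set where
  s01 r01 s10 r10 : Act

_==ᵃ_ : Act → Act → Bool
s01 ==ᵃ s01 = true
r01 ==ᵃ r01 = true
s10 ==ᵃ s10 = true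
r10 ==ᵃ r10 = true
_ ==ᵃ _ = false

sendOf : Proc → Act
sendOf p0 = s01
sendOf p1 = s10

recvOf : Proc → Act
recvOf p0 = r01
recvOf p1 = r10

-- events of M_m: (p , n) is the n-th (0-indexed) event of process p
V : Set
V = Proc × ℕ

alt0 : ℕ → Act
alt0 zero = r01
alt0 (suc zero) = s01
alt0 (suc (suc n)) = alt0 n

alt1 : ℕ → Act
alt1 zero = r10
alt1 (suc zero) = s10
alt1 (suc (suc n)) = alt1 n

-- process 0: (0!1)^m ((0?1)(0!1))^ω ; process 1: (1?0) ((1?0)(1!0))^ω
lab : ℕ → Proc → ℕ → Act
lab m p0 n = if n <ᵇ m then s01 else alt0 (n ∸ m)
lab m p1 zero = r10
lab m p1 (suc n) = alt1 n

λM : ℕ → V → Act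
λM m (p , n) = lab m p n

count : (ℕ → Act) → Act → ℕ → ℕ
count l a zero = 0
count l a (suc n) = if l n ==ᵃ a then suc (count l a n) else count l a n

ProcR : V → V → Set
ProcR (p , n) (q , n') = (q ≡ p) × (n' ≡ suc n)

-- FIFO message relation: k-th p!q matched with k-th q?p
MsgR : ℕ → V → V → Set
MsgR m (p , n) (q , n') =
  (q ≡ other p) × (lab m p n ≡ sendOf p) × (lab m q n' ≡ recvOf q)
  × (count (lab m p) (sendOf p) n ≡ count (lab m q) (recvOf q) n')

mutual
  data Path : Set where
    proc : Path
    msg  : Path
    test : Form → Path
    _⨾_  : Path → Path → Path
    _⊕_  : Path → Path → Path
    star : Path → Path

  data Form : Set where
    tt    : Form
    act   : Act → Form
    col   : Bool → Bool → Form
    _∨ᶠ_  : Form → Form → Form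
    ¬ᶠ_   : Form → Form
    ⟨_⟩_  : Path → Form → Form
    ⟨_⟩⁻¹_ : Path → Form → Form
    ⟨_∩_⟩_ : Path → Path → Form → Form

-- Semantics over (M_m , c), c : V → {0,1}² (0 = false, 1 = true)
mutual
  R : (m : ℕ) → (V → Bool × Bool) → Path → V → V → Set
  R m c proc v w = ProcR v w
  R m c msg v w = MsgR m v w
  R m c (test α) v w = (v ≡ w) × Sat m c α v
  R m c (π₁ ⨾ π₂) v w = ∃ λ u → R m c π₁ v u × R m c π₂ u w
  R m c (π₁ ⊕ π₂) v w = R m c π₁ v w ⊎ R m c π₂ v w
  R m c (star π) v w = Star (R m c π) v w

  -- Rb π v w : (w , v) ∈ R_π' , π' = π with concatenations reversed
  Rb : (m : ℕ) → (V → Bool × Bool) → Path → V → V → Set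
  Rb m c proc v w = ProcR w v
  Rb m c msg v w = MsgR m w v
  Rb m c (test α) v w = (v ≡ w) × Sat m c α v
  Rb m c (π₁ ⨾ π₂) v w = ∃ λ u → Rb m c π₁ v u × Rb m c π₂ u w
  Rb m c (π₁ ⊕ π₂) v w = Rb m c π₁ v w ⊎ Rb m c π₂ v w
  Rb m c (star π) v w = Star (Rb m c π) v w

  Sat : (m : ℕ) → (V → Bool × Bool) → Form → V → Set
  Sat m c tt v = Data.Unit.⊤
    where import Data.Unit
  Sat m c (act a) v = λM m v ≡ a
  Sat m c (col a b) v = c v ≡ (a , b)
  Sat m c (α ∨ᶠ β) v = Sat m c α v ⊎ Sat m c β v
  Sat m c (¬ᶠ α) v = ¬ Sat m c α v
  Sat m c (⟨ π ⟩ α) v = ∃ λ w → R m c π v w × Sat m c α w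
  Sat m c (⟨ π ⟩⁻¹ α) v = ∃ λ w → Rb m c π v w × Sat m c α w
  Sat m c (⟨ π₁ ∩ π₂ ⟩ α) v = ∃ λ w → R m c π₁ v w × R m c π₂ v w × Sat m c α w

Models : (m : ℕ) → (V → Bool × Bool) → Form → Set
Models m c α = (v : V) → Sat m c α v

-- f on the k-th (k ≥ 1) send event: ((m-k) mod m , (k-1) div m)
fk : (m : ℕ) .{{_ : NonZero m}} → ℕ → ℕ × ℕ
fk m k = ((+ m - + k) %ℕ m , (k ∸ 1) / m)

-- IsG m i j v : v is the 0!1-event with f v = (i , j), i.e. v = g (i , j)
IsG : (m : ℕ) .{{_ : NonZero m}} → ℕ → ℕ → V → Set
IsG m i j (p , n) =
  (p ≡ p0) × (lab m p0 n ≡ s01) × (fk m (suc (count (lab m p0) s01 n)) ≡ (i , j))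

-- Number the 0!1-events of process 0 from 0; the s-th one is g (i , j) with s = j m + (m - 1 - i).
-- In M_m the path next (proc, skipping one 0?1-event if there is one) leads from the s-th send to the
-- (s+1)-th, and jump = msg;proc;msg;proc leads from the (t+1)-th send via the (t+1)-th 1?0, the t-th 1!0
-- and the t-th 0?1 to the (m+t)-th send.  On the grid, next;jump is (i , j) ↦ (i , j+1) and jump is
-- (i , j) ↦ (i+1 , j+1) for i < m-1.  So (next;jump)* from g (i , j) reaches exactly row i to the right,
-- while descending with next through events not coloured (0,0) down to g (0 , j) and then climbing
-- with jump as long as the colour is not (0,0) reaches exactly the diagonal g (n , n + j), n < m.
-- The two meet only in g (i , i + j), so α says that g (i , j) has the colour of g (i , i + j).

module Submission where

open import Defs
open import Data.Bool using (Bool; true; false)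
open import Data.Empty using (⊥-elim)
open import Data.Nat
open import Data.Nat.Properties
open import Data.Nat.DivMod
open import Data.Nat.Divisibility using (n∣m*n)
open import Data.Integer as ℤ using (-[1+_]; _⊖_)
import Data.Integer.Properties as ℤP
open import Data.Integer.DivMod using (_%ℕ_)
open import Data.Product using (Σ; ∃; _×_; _,_; proj₁; proj₂)
open import Data.Product.Properties using (,-injective)
open import Data.Sum using (_⊎_; inj₁; inj₂)
open import Function.Bundles using (_⇔_; mk⇔; Equivalence)
open import Relation.Nullary using (¬_; yes; no)
open import Relation.Binary.Definitions using (tri<; tri≈; tri>)
open import Relation.Binary.PropositionalEquality
open import Relation.Binary.Construct.Closure.ReflexiveTransitive using (Star; ε; _◅_; _◅◅_)

==ᵃ-refl : ∀ a → (a ==ᵃ a) ≡ true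
==ᵃ-refl s01 = refl
==ᵃ-refl r01 = refl
==ᵃ-refl s10 = refl
==ᵃ-refl r10 = refl

module _ (l : ℕ → Act) (a : Act) where

  count-hit : ∀ {n} → l n ≡ a → count l a (suc n) ≡ suc (count l a n)
  count-hit ln≡a rewrite ln≡a | ==ᵃ-refl a = refl

  count-miss : ∀ {n b} → l n ≡ b → (b ==ᵃ a) ≡ false → count l a (suc n) ≡ count l a n
  count-miss ln≡b b≠a rewrite ln≡b | b≠a = refl

  count-all : ∀ n → (∀ i → i < n → l i ≡ a) → count l a n ≡ n
  count-all zero _ = refl
  count-all (suc n) all =
    trans (count-hit (all n ≤-refl)) (cong suc (count-all n (λ i i<n → all i (m<n⇒m<1+n i<n))))

  count-none : ∀ {b} n → (∀ i → i < n → l i ≡ b) → (b ==ᵃ a) ≡ false → count l a n ≡ 0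
  count-none zero _ _ = refl
  count-none (suc n) all b≠a =
    trans (count-miss (all n ≤-refl) b≠a) (count-none n (λ i i<n → all i (m<n⇒m<1+n i<n)) b≠a)

  count-≤-suc : ∀ n → count l a n ≤ count l a (suc n)
  count-≤-suc n with l n ==ᵃ a
  ... | true = n≤1+n _
  ... | false = ≤-refl

  count-mono : ∀ k {n} → count l a n ≤ count l a (k + n)
  count-mono zero = ≤-refl
  count-mono (suc k) = ≤-trans (count-mono k) (count-≤-suc _)

  count-< : ∀ {n n'} → l n ≡ a → n < n' → count l a n < count l a n'
  count-< {n} {n'} ln≡a n<n' = begin-strict
    count l a n                    <⟨ n<1+n _ ⟩
    suc (count l a n)              ≡⟨ count-hit ln≡a ⟨
    count l a (suc n)              ≤⟨ count-mono (n' ∸ suc n) ⟩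
    count l a (n' ∸ suc n + suc n) ≡⟨ cong (count l a) (m∸n+n≡m n<n') ⟩
    count l a n'                   ∎
    where open ≤-Reasoning

  count-injective : ∀ {n n'} → l n ≡ a → l n' ≡ a → count l a n ≡ count l a n' → n ≡ n'
  count-injective {n} {n'} ln≡a ln'≡a eq with <-cmp n n'
  ... | tri< n<n' _ _ = ⊥-elim (<-irrefl eq (count-< ln≡a n<n'))
  ... | tri≈ _ n≡n' _ = n≡n'
  ... | tri> _ _ n'<n = ⊥-elim (<-irrefl (sym eq) (count-< ln'≡a n'<n))

  count-+ : ∀ k n → count l a (k + n) ≡ count l a k + count (λ i → l (k + i)) a n
  count-+ k zero = trans (cong (count l a) (+-identityʳ k)) (sym (+-identityʳ _))
  count-+ k (suc n) rewrite +-suc k n with l (k + n) ==ᵃ a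
  ... | true = trans (cong suc (count-+ k n)) (sym (+-suc _ _))
  ... | false = count-+ k n

count-cong : ∀ {l l'} a → (∀ i → l i ≡ l' i) → ∀ n → count l a n ≡ count l' a n
count-cong a l≗l' zero = refl
count-cong {l} {l'} a l≗l' (suc n) rewrite l≗l' n | count-cong a l≗l' n = refl

double : ℕ → ℕ
double zero = zero
double (suc t) = suc (suc (double t))

count-periodic : ∀ {l} a → (∀ n → l (suc (suc n)) ≡ l n) →
                 ∀ t → count l a (double t) ≡ t * count l a 2
count-periodic a periodic zero = refl
count-periodic {l} a periodic (suc t) = begin
  count l a (2 + double t)                          ≡⟨ count-+ l a 2 (double t) ⟩
  count l a 2 + count (λ i → l (2 + i)) a (double t) ≡⟨ cong (count l a 2 +_) (count-cong a periodic (double t)) ⟩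
  count l a 2 + count l a (double t)                 ≡⟨ cong (count l a 2 +_) (count-periodic a periodic t) ⟩
  count l a 2 + t * count l a 2                      ∎
  where open ≡-Reasoning

alt0-cases : ∀ x → alt0 x ≡ s01 ⊎ (alt0 x ≡ r01 × alt0 (suc x) ≡ s01)
alt0-cases zero = inj₂ (refl , refl)
alt0-cases (suc zero) = inj₁ refl
alt0-cases (suc (suc x)) = alt0-cases x

alt0-even : ∀ t → alt0 (double t) ≡ r01
alt0-even zero = refl
alt0-even (suc t) = alt0-even t

alt0-odd : ∀ t → alt0 (suc (double t)) ≡ s01
alt0-odd zero = refl
alt0-odd (suc t) = alt0-odd t

alt1-even : ∀ t → alt1 (double t) ≡ r10
alt1-even zero = refl
alt1-even (suc t) = alt1-even t

alt1-odd : ∀ t → alt1 (suc (double t)) ≡ s10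
alt1-odd zero = refl
alt1-odd (suc t) = alt1-odd t

alt1≡s10⇒odd : ∀ x → alt1 x ≡ s10 → ∃ λ t → x ≡ suc (double t)
alt1≡s10⇒odd (suc zero) _ = 0 , refl
alt1≡s10⇒odd (suc (suc x)) eq with alt1≡s10⇒odd x eq
... | t , refl = suc t , refl

alt1≢s01 : ∀ x → alt1 x ≢ s01
alt1≢s01 (suc (suc x)) = alt1≢s01 x

lab₀-low : ∀ {m n} → n < m → lab m p0 n ≡ s01
lab₀-low {suc m} {zero} _ = refl
lab₀-low {suc m} {suc n} (s≤s n<m) = lab₀-low n<m

lab₀-high : ∀ m x → lab m p0 (m + x) ≡ alt0 x
lab₀-high zero x = refl
lab₀-high (suc m) x = lab₀-high m x

lab₀-cases : ∀ m n → lab m p0 n ≡ s01 ⊎ (lab m p0 n ≡ r01 × lab m p0 (suc n) ≡ s01)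
lab₀-cases zero n = alt0-cases n
lab₀-cases (suc m) zero = inj₁ refl
lab₀-cases (suc m) (suc n) = lab₀-cases m n

lab₁≢s01 : ∀ m n → lab m p1 n ≢ s01
lab₁≢s01 m (suc n) = alt1≢s01 n

lab₁≡s10⇒even : ∀ m n → lab m p1 n ≡ s10 → ∃ λ t → n ≡ suc (suc (double t))
lab₁≡s10⇒even m (suc n) eq with alt1≡s10⇒odd n eq
... | t , refl = t , refl

-- k counts from 0: count only sees the events before position n.
record IsNth (m : ℕ) (p : Proc) (a : Act) (k n : ℕ) : Set where
  constructor _,_
  field
    labelled : lab m p n ≡ a
    counted  : count (lab m p) a n ≡ k

open IsNth

IsNth-unique : ∀ {m p a k n n'} → IsNth m p a k n → IsNth m p a k n' → n ≡ n'
IsNth-unique {m} {p} {a} (ln≡a , cn≡k) (ln'≡a , cn'≡k) =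
  count-injective (lab m p) a ln≡a ln'≡a (trans cn≡k (sym cn'≡k))

msg-intro : ∀ {m p k n n'} → IsNth m p (sendOf p) k n → IsNth m (other p) (recvOf (other p)) k n' →
            MsgR m (p , n) (other p , n')
msg-intro (send , cn≡k) (recv , cn'≡k) = refl , send , recv , trans cn≡k (sym cn'≡k)

module _ (m : ℕ) where

  count₀-high : ∀ a x → count (lab m p0) a (m + x) ≡ count (lab m p0) a m + count alt0 a x
  count₀-high a x =
    trans (count-+ (lab m p0) a m x) (cong (count (lab m p0) a m +_) (count-cong a (lab₀-high m) x))

  receive₀ : ∀ t → IsNth m p0 r01 t (m + double t)
  receive₀ t = trans (lab₀-high m _) (alt0-even t) , (begin
    count (lab m p0) r01 (m + double t)                ≡⟨ count₀-high r01 _ ⟩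
    count (lab m p0) r01 m + count alt0 r01 (double t) ≡⟨ cong₂ _+_ (count-none (lab m p0) r01 m (λ _ → lab₀-low) refl)
                                                                    (count-periodic r01 (λ _ → refl) t) ⟩
    t * 1                                              ≡⟨ *-identityʳ t ⟩
    t                                                  ∎)
    where open ≡-Reasoning

  send₀-high : ∀ t → IsNth m p0 s01 (m + t) (suc (m + double t))
  send₀-high t = trans (cong (lab m p0) (sym (+-suc m (double t)))) (trans (lab₀-high m _) (alt0-odd t)) , (begin
    count (lab m p0) s01 (suc (m + double t))          ≡⟨ count-miss (lab m p0) s01 (labelled (receive₀ t)) refl ⟩
    count (lab m p0) s01 (m + double t)                ≡⟨ count₀-high s01 _ ⟩
    count (lab m p0) s01 m + count alt0 s01 (double t) ≡⟨ cong₂ _+_ (count-all (lab m p0) s01 m (λ _ → lab₀-low))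
                                                                    (count-periodic s01 (λ _ → refl) t) ⟩
    m + t * 1                                          ≡⟨ cong (m +_) (*-identityʳ t) ⟩
    m + t                                              ∎)
    where open ≡-Reasoning

  receive₁ : ∀ t → IsNth m p1 r10 (suc t) (suc (double t))
  receive₁ t = alt1-even t , trans (count-+ (lab m p1) r10 1 (double t))
                                   (cong suc (trans (count-periodic r10 (λ _ → refl) t) (*-identityʳ t)))

  send₁ : ∀ t → IsNth m p1 s10 t (suc (suc (double t)))
  send₁ t = alt1-odd t , (begin
    count (lab m p1) s10 (1 + suc (double t)) ≡⟨ count-+ (lab m p1) s10 1 (suc (double t)) ⟩
    count alt1 s10 (suc (double t))           ≡⟨ count-miss alt1 s10 {double t} (alt1-even t) refl ⟩
    count alt1 s10 (double t)                 ≡⟨ count-periodic s10 (λ _ → refl) t ⟩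
    t * 1                                     ≡⟨ *-identityʳ t ⟩
    t                                         ∎)
    where open ≡-Reasoning

  send-here-or-next : ∀ {n s} → count (lab m p0) s01 n ≡ s →
              IsNth m p0 s01 s n ⊎ (lab m p0 n ≡ r01 × IsNth m p0 s01 s (suc n))
  send-here-or-next {n} cn≡s with lab₀-cases m n
  ... | inj₁ ln≡s01 = inj₁ (ln≡s01 , cn≡s)
  ... | inj₂ (ln≡r01 , ln+1≡s01) =
    inj₂ (ln≡r01 , ln+1≡s01 , trans (count-miss (lab m p0) s01 ln≡r01 refl) cn≡s)

  count-after-send : ∀ {s n} → IsNth m p0 s01 s n → count (lab m p0) s01 (suc n) ≡ suc s
  count-after-send (ln≡s01 , cn≡s) = trans (count-hit (lab m p0) s01 ln≡s01) (cong suc cn≡s)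

  send-at-or-after : ∀ n {s} → count (lab m p0) s01 n ≡ s → ∃ (IsNth m p0 s01 s)
  send-at-or-after n cn≡s with send-here-or-next cn≡s
  ... | inj₁ nth = n , nth
  ... | inj₂ (_ , nth) = suc n , nth

  -- Opaque so that positions are only ever used through sendPos-nth and sendPos-unique.
  opaque
    send-exists : ∀ s → ∃ (IsNth m p0 s01 s)
    send-exists zero = send-at-or-after 0 refl
    send-exists (suc s) with send-exists s
    ... | n , nth = send-at-or-after (suc n) (count-after-send nth)

  sendPos : ℕ → ℕ
  sendPos s = proj₁ (send-exists s)

  sendPos-nth : ∀ s → IsNth m p0 s01 s (sendPos s)
  sendPos-nth s = proj₂ (send-exists s)

  sendPos-unique : ∀ {s n} → IsNth m p0 s01 s n → n ≡ sendPos s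
  sendPos-unique {s} nth = IsNth-unique nth (sendPos-nth s)

  send : ℕ → V
  send s = p0 , sendPos s

  send-injective : ∀ {s s'} → send s ≡ send s' → s ≡ s'
  send-injective {s} {s'} eq =
    trans (sym (counted (sendPos-nth s)))
          (trans (cong (λ v → count (lab m p0) s01 (proj₂ v)) eq) (counted (sendPos-nth s')))

next : Path
next = (proc ⊕ (proc ⨾ (test (act r01) ⨾ proc))) ⨾ test (act s01)

jump : Path
jump = msg ⨾ (proc ⨾ (msg ⨾ proc))

step : Path
step = next ⨾ jump

module _ (m : ℕ) (c : V → Bool × Bool) where

  next-sound : ∀ s {w} → R m c next (send m s) w → w ≡ send m (suc s)
  next-sound s (_ , inj₁ (refl , refl) , refl , ln≡s01) =
    cong (p0 ,_) (sendPos-unique m (ln≡s01 , count-after-send m (sendPos-nth m s)))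
  next-sound s (_ , inj₂ (_ , (refl , refl) , _ , (refl , ln≡r01) , (refl , refl)) , refl , ln≡s01) =
    cong (p0 ,_) (sendPos-unique m (ln≡s01 ,
      trans (count-miss (lab m p0) s01 ln≡r01 refl) (count-after-send m (sendPos-nth m s))))

  next-complete : ∀ s → R m c next (send m s) (send m (suc s))
  next-complete s with send-here-or-next m (count-after-send m (sendPos-nth m s))
  ... | inj₁ nth@(ln≡s01 , _) =
    _ , inj₁ (refl , refl) , cong (p0 ,_) (sendPos-unique m nth) , ln≡s01
  ... | inj₂ (ln≡r01 , nth@(ln≡s01 , _)) =
    _ , inj₂ (_ , (refl , refl) , _ , (refl , ln≡r01) , (refl , refl)) ,
    cong (p0 ,_) (sendPos-unique m nth) , ln≡s01

  jump-sound : ∀ s {w} → R m c jump (send m s) w → ∃ λ t → s ≡ suc t × w ≡ send m (m + t)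
  jump-sound s ((_ , n₁) , (refl , _ , ln₁≡r10 , cs≡cn₁) , _ , (refl , refl) ,
                (_ , n₃) , (refl , ln₂≡s10 , ln₃≡r01 , cn₂≡cn₃) , (refl , refl))
    with lab₁≡s10⇒even m (suc n₁) ln₂≡s10
  ... | t , refl = t , s≡1+t , cong (p0 ,_) (trans (cong suc n₃≡m+2t) (sendPos-unique m (send₀-high m t)))
    where
    s≡1+t : s ≡ suc t
    s≡1+t = trans (sym (counted (sendPos-nth m s))) (trans cs≡cn₁ (counted (receive₁ m t)))
    n₃≡m+2t : n₃ ≡ m + double t
    n₃≡m+2t = IsNth-unique (ln₃≡r01 , trans (sym cn₂≡cn₃) (counted (send₁ m t))) (receive₀ m t)

  jump-complete : ∀ t → R m c jump (send m (suc t)) (send m (m + t))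
  jump-complete t =
    (p1 , suc (double t)) , msg-intro (sendPos-nth m (suc t)) (receive₁ m t) ,
    (p1 , suc (suc (double t))) , (refl , refl) ,
    (p0 , m + double t) , msg-intro (send₁ m t) (receive₀ m t) ,
    (refl , sym (sendPos-unique m (send₀-high m t)))

  step-sound : ∀ s {w} → R m c step (send m s) w → w ≡ send m (m + s)
  step-sound s (_ , r-next , r-jump) with next-sound s r-next
  ... | refl with jump-sound (suc s) r-jump
  ... | _ , refl , refl = refl

  step-complete : ∀ s → R m c step (send m s) (send m (m + s))
  step-complete s = send m (suc s) , next-complete s , jump-complete s

module Coordinates (m' : ℕ) where

  m : ℕ
  m = suc m'

  -- g (i , j) is the send of index idx i j, since fk m (suc s) = (m' ∸ s % m , s / m).
  idx : ℕ → ℕ → ℕ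
  idx i j = j * m + (m' ∸ i)

  m'∸i<m : ∀ i → m' ∸ i < m
  m'∸i<m i = s≤s (m∸n≤m m' i)

  idx-down : ∀ {i} j → suc i ≤ m' → suc (idx (suc i) j) ≡ idx i j
  idx-down {i} j i<m' = trans (sym (+-suc (j * m) _)) (cong (j * m +_) (sym (+-∸-assoc 1 i<m')))

  idx-wrap : ∀ j → suc (idx 0 j) ≡ idx m' (suc j)
  idx-wrap j = begin
    suc (j * m + m')         ≡⟨ sym (+-suc (j * m) m') ⟩
    j * m + m                ≡⟨ +-comm (j * m) m ⟩
    m + j * m                ≡⟨ sym (+-identityʳ _) ⟩
    m + j * m + 0            ≡⟨ cong (m + j * m +_) (sym (n∸n≡0 m')) ⟩
    idx m' (suc j)           ∎
    where open ≡-Reasoning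

  idx-right : ∀ i j → m + idx i j ≡ idx i (suc j)
  idx-right i j = sym (+-assoc m (j * m) (m' ∸ i))

  idx-% : ∀ i j → idx i j % m ≡ m' ∸ i
  idx-% i j = trans (%-remove-+ˡ (m' ∸ i) (n∣m*n j)) (m<n⇒m%n≡m (m'∸i<m i))

  idx-/ : ∀ i j → idx i j / m ≡ j
  idx-/ i j = begin
    (j * m + (m' ∸ i)) / m       ≡⟨ +-distrib-/-∣ˡ (m' ∸ i) (n∣m*n j) ⟩
    j * m / m + (m' ∸ i) / m     ≡⟨ cong₂ _+_ (m*n/n≡m j m) (m<n⇒m/n≡0 (m'∸i<m i)) ⟩
    j + 0                        ≡⟨ +-identityʳ j ⟩
    j                            ∎
    where open ≡-Reasoning

  -[1+]%ℕ : ∀ y → -[1+ y ] %ℕ m ≡ m' ∸ y % m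
  -[1+]%ℕ y with suc y % m in eq
  ... | zero = sym (trans (cong (m' ∸_) (%-pred-≡0 {y} {m} eq)) (n∸n≡0 m'))
  ... | suc r = cong (m' ∸_) (sym (≤-antisym
      ([1+m%d]≤1+n⇒[m%d]≤n y r m (subst (0 <_) (sym eq) z<s) (≤-reflexive eq))
      (m<[1+n%d]⇒m≤[n%d] y m (≤-reflexive (sym eq)))))

  m⊖[1+s]%ℕm : ∀ s → (m ⊖ suc s) %ℕ m ≡ m' ∸ s % m
  m⊖[1+s]%ℕm s with s <? m
  ... | yes s<m = begin
    (m ⊖ suc s) %ℕ m  ≡⟨ cong (_%ℕ m) (ℤP.⊖-≥ s<m) ⟩
    (m' ∸ s) % m      ≡⟨ m<n⇒m%n≡m (m'∸i<m s) ⟩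
    m' ∸ s            ≡⟨ cong (m' ∸_) (m<n⇒m%n≡m s<m) ⟨
    m' ∸ s % m        ∎
    where open ≡-Reasoning
  ... | no s≮m = begin
    (m ⊖ suc s) %ℕ m       ≡⟨ cong (_%ℕ m) (ℤP.⊖-< (s≤s m≤s)) ⟩
    ℤ.- ℤ.+ (suc s ∸ m) %ℕ m   ≡⟨ cong (λ k → ℤ.- ℤ.+ k %ℕ m) (+-∸-assoc 1 m≤s) ⟩
    -[1+ s ∸ m ] %ℕ m      ≡⟨ -[1+]%ℕ (s ∸ m) ⟩
    m' ∸ (s ∸ m) % m       ≡⟨ cong (m' ∸_) (m≤n⇒[n∸m]%m≡n%m m≤s) ⟩
    m' ∸ s % m             ∎
    where
    open ≡-Reasoning
    m≤s : m ≤ s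
    m≤s = ≮⇒≥ s≮m

  fk-suc : ∀ s → fk m (suc s) ≡ (m' ∸ s % m , s / m)
  fk-suc s = cong (_, s / m) (m⊖[1+s]%ℕm s)

  fk-idx : ∀ {i} j → i ≤ m' → fk m (suc (idx i j)) ≡ (i , j)
  fk-idx {i} j i≤m' = trans (fk-suc (idx i j))
    (cong₂ _,_ (trans (cong (m' ∸_) (idx-% i j)) (m∸[m∸n]≡n i≤m')) (idx-/ i j))

  fk-inverse : ∀ s {i j} → fk m (suc s) ≡ (i , j) → i ≤ m' × s ≡ idx i j
  fk-inverse s h with ,-injective (trans (sym (fk-suc s)) h)
  ... | refl , refl = m∸n≤m m' (s % m) , (begin
    s                             ≡⟨ m≡m%n+[m/n]*n s m ⟩
    s % m + s / m * m             ≡⟨ +-comm (s % m) _ ⟩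
    s / m * m + s % m             ≡⟨ cong (s / m * m +_) (m∸[m∸n]≡n (≤-pred (m%n<n s m))) ⟨
    idx (m' ∸ s % m) (s / m)      ∎)
    where open ≡-Reasoning

  idx-injective : ∀ {i i'} j j' → i ≤ m' → i' ≤ m' → idx i j ≡ idx i' j' → (i , j) ≡ (i' , j')
  idx-injective j j' i≤m' i'≤m' eq =
    trans (sym (fk-idx j i≤m')) (trans (cong (λ s → fk m (suc s)) eq) (fk-idx j' i'≤m'))

module Grid (m' : ℕ) where

  open Coordinates m' public

  g : ℕ → ℕ → V
  g i j = send m (idx i j)

  g-IsG : ∀ i j → i ≤ m' → IsG m i j (g i j)
  g-IsG i j i≤m' = refl , labelled (sendPos-nth m (idx i j)) ,
    trans (cong (λ s → fk m (suc s)) (counted (sendPos-nth m (idx i j)))) (fk-idx j i≤m')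

  IsG⇒g : ∀ {i j} n → IsG m i j (p0 , n) → i ≤ m' × (p0 , n) ≡ g i j
  IsG⇒g n (refl , ln≡s01 , fk≡ij) with fk-inverse _ fk≡ij
  ... | i≤m' , cn≡idx = i≤m' , cong (p0 ,_) (sendPos-unique m (ln≡s01 , cn≡idx))

  module _ (c : V → Bool × Bool) where

    row-step : ∀ i j {w} → R m c step (g i j) w → w ≡ g i (suc j)
    row-step i j r = trans (step-sound m c (idx i j) r) (cong (send m) (idx-right i j))

    row-sound : ∀ i j {w} → Star (R m c step) (g i j) w → ∃ λ j' → w ≡ g i j'
    row-sound i j ε = j , refl
    row-sound i j (r ◅ rs) with row-step i j r
    ... | refl = row-sound i (suc j) rs

    row-complete : ∀ i j k → Star (R m c step) (g i j) (g i (k + j))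
    row-complete i j zero = ε
    row-complete i j (suc k) =
      row-complete i j k ◅◅ (subst (R m c step (g i (k + j))) (cong (send m) (idx-right i (k + j)))
                                   (step-complete m c (idx i (k + j))) ◅ ε)

    next-down : ∀ i j {w} → suc i ≤ m' → R m c next (g (suc i) j) w → w ≡ g i j
    next-down i j i<m' r = trans (next-sound m c _ r) (cong (send m) (idx-down j i<m'))

    next-down-complete : ∀ i j → suc i ≤ m' → R m c next (g (suc i) j) (g i j)
    next-down-complete i j i<m' =
      subst (R m c next (g (suc i) j)) (cong (send m) (idx-down j i<m')) (next-complete m c _)

    jump-up : ∀ i j {w} → suc i ≤ m' → R m c jump (g i j) w → w ≡ g (suc i) (suc j)
    jump-up i j i<m' r with jump-sound m c (idx i j) r
    ... | t , idx≡1+t , refl = cong (send m) (trans (cong (m +_) t≡idx) (idx-right (suc i) j))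
      where
      t≡idx : t ≡ idx (suc i) j
      t≡idx = suc-injective (trans (sym idx≡1+t) (sym (idx-down j i<m')))

    jump-up-complete : ∀ i j → suc i ≤ m' → R m c jump (g i j) (g (suc i) (suc j))
    jump-up-complete i j i<m' =
      subst₂ (λ a b → R m c jump (send m a) (send m b)) (idx-down j i<m') (idx-right (suc i) j)
             (jump-complete m c _)

    jump-wrap : ∀ j {w} → R m c jump (g m' j) w → w ≡ g 0 j
    jump-wrap j r with jump-sound m c (idx m' j) r
    jump-wrap zero r | t , idx≡1+t , _ = ⊥-elim (0≢1+n (trans (sym (n∸n≡0 m')) idx≡1+t))
    jump-wrap (suc j) r | t , idx≡1+t , refl = cong (send m) (trans (cong (m +_) t≡idx) (idx-right 0 j))
      where
      t≡idx : t ≡ idx 0 j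
      t≡idx = suc-injective (trans (sym idx≡1+t) (sym (idx-wrap j)))

colourMeet : Path → Path → Bool → Bool → Form
colourMeet π₁ π₂ a b = ⟨ test (col a b) ⟩ (⟨ π₁ ∩ π₂ ⟩ col a b)

sameColourAt : Path → Path → Form
sameColourAt π₁ π₂ =
  colourMeet π₁ π₂ false false ∨ᶠ (colourMeet π₁ π₂ false true ∨ᶠ
    (colourMeet π₁ π₂ true false ∨ᶠ colourMeet π₁ π₂ true true))

module _ (m : ℕ) (c : V → Bool × Bool) (π₁ π₂ : Path) where

  colourMeet-sound : ∀ {a b v} → Sat m c (colourMeet π₁ π₂ a b) v →
                     ∃ λ w → R m c π₁ v w × R m c π₂ v w × c w ≡ c v
  colourMeet-sound (_ , (refl , cv≡ab) , w , r₁ , r₂ , cw≡ab) = w , r₁ , r₂ , trans cw≡ab (sym cv≡ab)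

  sameColourAt-sound : ∀ {v} → Sat m c (sameColourAt π₁ π₂) v →
                       ∃ λ w → R m c π₁ v w × R m c π₂ v w × c w ≡ c v
  sameColourAt-sound (inj₁ meet) = colourMeet-sound meet
  sameColourAt-sound (inj₂ (inj₁ meet)) = colourMeet-sound meet
  sameColourAt-sound (inj₂ (inj₂ (inj₁ meet))) = colourMeet-sound meet
  sameColourAt-sound (inj₂ (inj₂ (inj₂ meet))) = colourMeet-sound meet

  sameColourAt-complete : ∀ {v w} → R m c π₁ v w → R m c π₂ v w → c w ≡ c v →
                          Sat m c (sameColourAt π₁ π₂) v
  sameColourAt-complete {v} {w} r₁ r₂ cw≡cv with c v
  ... | false , false = inj₁ (v , (refl , refl) , w , r₁ , r₂ , cw≡cv)
  ... | false , true = inj₂ (inj₁ (v , (refl , refl) , w , r₁ , r₂ , cw≡cv))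
  ... | true , false = inj₂ (inj₂ (inj₁ (v , (refl , refl) , w , r₁ , r₂ , cw≡cv)))
  ... | true , true = inj₂ (inj₂ (inj₂ (v , (refl , refl) , w , r₁ , r₂ , cw≡cv)))

zeroColour : Form
zeroColour = col false false

row : Path
row = star step

diagonal : Path
diagonal = star (test (¬ᶠ zeroColour) ⨾ next) ⨾ (test zeroColour ⨾ star (jump ⨾ test (¬ᶠ zeroColour)))

α : Form
α = (¬ᶠ act s01) ∨ᶠ sameColourAt row diagonal

module Periodicity (m' : ℕ) (c : V → Bool × Bool)
  (zero-row : (i j : ℕ) (v : V) → i < suc m' → IsG (suc m') i j v → (c v ≡ (false , false) ⇔ i ≡ 0))
  where

  open Grid m'
  open Equivalence

  zero-colour⇔ : ∀ i j → i ≤ m' → c (g i j) ≡ (false , false) ⇔ i ≡ 0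
  zero-colour⇔ i j i≤m' = zero-row i j (g i j) (s≤s i≤m') (g-IsG i j i≤m')

  nonzero-row : ∀ i j → suc i ≤ m' → ¬ (c (g (suc i) j) ≡ (false , false))
  nonzero-row i j i<m' cg≡0 = 1+n≢0 (to (zero-colour⇔ (suc i) j i<m') cg≡0)

  descend-sound : ∀ i j {u} → i ≤ m' → Star (R m c (test (¬ᶠ zeroColour) ⨾ next)) (g i j) u →
                  c u ≡ (false , false) → u ≡ g 0 j
  descend-sound i j i≤m' ε cu≡0 = cong (λ k → g k j) (to (zero-colour⇔ i j i≤m') cu≡0)
  descend-sound zero j _ ((_ , (refl , nonzero) , _) ◅ _) _ =
    ⊥-elim (nonzero (from (zero-colour⇔ 0 j z≤n) refl))
  descend-sound (suc i) j i<m' ((_ , (refl , _) , r) ◅ rs) cu≡0 with next-down c i j i<m' r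
  ... | refl = descend-sound i j (<⇒≤ i<m') rs cu≡0

  descend-complete : ∀ i j → i ≤ m' → Star (R m c (test (¬ᶠ zeroColour) ⨾ next)) (g i j) (g 0 j)
  descend-complete zero j _ = ε
  descend-complete (suc i) j i<m' =
    (g (suc i) j , (refl , nonzero-row i j i<m') , next-down-complete c i j i<m') ◅
    descend-complete i j (<⇒≤ i<m')

  climb-step : ∀ n j {w} → n ≤ m' → R m c (jump ⨾ test (¬ᶠ zeroColour)) (g n (n + j)) w →
               suc n ≤ m' × w ≡ g (suc n) (suc n + j)
  climb-step n j n≤m' (_ , r , (refl , nonzero)) with m≤n⇒m<n∨m≡n n≤m'
  ... | inj₁ n<m' = n<m' , jump-up c n (n + j) n<m' r
  ... | inj₂ refl = ⊥-elim (nonzero (subst (λ w → c w ≡ (false , false)) (sym (jump-wrap c (m' + j) r))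
                                           (from (zero-colour⇔ 0 (m' + j) z≤n) refl)))

  climb-sound : ∀ n j {w} → n ≤ m' → Star (R m c (jump ⨾ test (¬ᶠ zeroColour))) (g n (n + j)) w →
                ∃ λ n' → n' ≤ m' × w ≡ g n' (n' + j)
  climb-sound n j n≤m' ε = n , n≤m' , refl
  climb-sound n j n≤m' (r ◅ rs) with climb-step n j n≤m' r
  ... | n<m' , refl = climb-sound (suc n) j n<m' rs

  climb-complete : ∀ n j → n ≤ m' → Star (R m c (jump ⨾ test (¬ᶠ zeroColour))) (g 0 j) (g n (n + j))
  climb-complete zero j _ = ε
  climb-complete (suc n) j n<m' =
    climb-complete n j (<⇒≤ n<m') ◅◅
      ((g (suc n) (suc n + j) , jump-up-complete c n (n + j) n<m' , (refl , nonzero-row n (suc n + j) n<m')) ◅ ε)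

  row∩diagonal-sound : ∀ i j {w} → i ≤ m' → R m c row (g i j) w → R m c diagonal (g i j) w →
                       w ≡ g i (i + j)
  row∩diagonal-sound i j i≤m' r (_ , d , _ , (refl , cu≡0) , cl)
    with row-sound c i j r | descend-sound i j i≤m' d cu≡0
  ... | j' , refl | refl with climb-sound 0 j z≤n cl
  ... | n , n≤m' , eq with ,-injective (idx-injective j' (n + j) i≤m' n≤m' (send-injective m eq))
  ... | refl , refl = refl

  diagonal-complete : ∀ i j → i ≤ m' → R m c diagonal (g i j) (g i (i + j))
  diagonal-complete i j i≤m' =
    g 0 j , descend-complete i j i≤m' ,
    g 0 j , (refl , from (zero-colour⇔ 0 j z≤n) refl) , climb-complete i j i≤m'

  Periodic : Set
  Periodic = (i j : ℕ) (v w : V) → i < m → IsG m i j v → IsG m i (j + i) w → c v ≡ c w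

  models⇒periodic : Models m c α → Periodic
  models⇒periodic model i j (p0 , n) (p0 , n') _ v∈G w∈G with IsG⇒g n v∈G | IsG⇒g n' w∈G
  ... | i≤m' , refl | _ , refl with model (g i j)
  ... | inj₁ not-send = ⊥-elim (not-send (labelled (sendPos-nth m (idx i j))))
  ... | inj₂ same with sameColourAt-sound m c row diagonal same
  ... | _ , r , d , cw≡cv with row∩diagonal-sound i j i≤m' r d
  ... | refl = trans (sym cw≡cv) (cong (λ k → c (g i k)) (+-comm i j))

  periodic⇒sameColour : Periodic → ∀ i j → i ≤ m' → Sat m c (sameColourAt row diagonal) (g i j)
  periodic⇒sameColour periodic i j i≤m' =
    sameColourAt-complete m c row diagonal (row-complete c i j i) (diagonal-complete i j i≤m')
      (sym (periodic i j _ _ (s≤s i≤m') (g-IsG i j i≤m')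
        (subst (λ k → IsG m i k (g i (i + j))) (+-comm i j) (g-IsG i (i + j) i≤m'))))

  periodic⇒models : Periodic → Models m c α
  periodic⇒models _ (p1 , n) = inj₁ (lab₁≢s01 m n)
  periodic⇒models periodic (p0 , n) with lab₀-cases m n
  ... | inj₂ (ln≡r01 , _) = inj₁ (λ ln≡s01 → r01≢s01 (trans (sym ln≡r01) ln≡s01))
    where
    r01≢s01 : r01 ≢ s01
    r01≢s01 ()
  ... | inj₁ ln≡s01 with fk m (suc (count (lab m p0) s01 n)) in fk≡ij
  ... | i , j with IsG⇒g n (refl , ln≡s01 , fk≡ij)
  ... | i≤m' , v≡g =
    inj₂ (subst (Sat m c (sameColourAt row diagonal)) (sym v≡g) (periodic⇒sameColour periodic i j i≤m'))

lemma7p1 : Σ Form λ α → (m : ℕ) → .{{_ : NonZero m}} → (c : V → Bool × Bool)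
    → ((i j : ℕ) (v : V) → i < m → IsG m i j v → (c v ≡ (false , false) ⇔ i ≡ 0))
    → (Models m c α ⇔ ((i j : ℕ) (v w : V) → i < m → IsG m i j v → IsG m i (j + i) w → c v ≡ c w))
lemma7p1 = α , λ where
  (suc m') c zero-row → let open Periodicity m' c zero-row in mk⇔ models⇒periodic periodic⇒models
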